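{- Let $X_0,X_1,\dots,X_N$ be vectors in $\mathbb{R}^m$ such that (1) $X_0=0$; (2) for each $1\le t\le N$, $X_t$ and $X_{t-1}$ differ in exactly one coordinate, by $+1$ or $-1$; (3) for every $1\le i\le m$ there exists $t$ such that $X_t$ and $X_{t-1}$ differ in the $i$-th coordinate. Then there are indices $t_1,\dots,t_m$ such that $X_{t_1},\dots,X_{t_m}$ form a basis of $\mathbb{R}^m$. -}

module Defs where

open import Data.Nat using (ℕ; zero; suc)
open import Data.Fin using (Fin; zero; suc; inject₁)
open import Data.Integer as ℤ using (ℤ)
open import Data.Rational as ℚ using (ℚ; 0ℚ; _+_; _*_)
open import Data.Product using (Σ; ∃; _×_)
open import Data.Sum using (_⊎_)
open import Relation.Binary.PropositionalEquality using (_≡_; _≢_)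

sumFin : ∀ {n} → (Fin n → ℚ) → ℚ
sumFin {zero}  f = 0ℚ
sumFin {suc n} f = f zero + sumFin (λ j → f (suc j))

linComb : ∀ {k m} → (Fin k → ℚ) → (Fin k → Fin m → ℚ) → Fin m → ℚ
linComb c v i = sumFin (λ j → c j * v j i)

LinearlyIndependent : ∀ {k m} → (Fin k → Fin m → ℚ) → Set
LinearlyIndependent v =
  ∀ (c : Fin _ → ℚ) → (∀ i → linComb c v i ≡ 0ℚ) → ∀ j → c j ≡ 0ℚ

Spans : ∀ {k m} → (Fin k → Fin m → ℚ) → Set
Spans {k} {m} v = ∀ (w : Fin m → ℚ) → ∃ λ (c : Fin k → ℚ) → ∀ i → linComb c v i ≡ w i

IsBasis : ∀ {k m} → (Fin k → Fin m → ℚ) → Set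
IsBasis v = LinearlyIndependent v × Spans v

-- Walk X_0,…,X_N in ℤ^m (X : Fin (suc N) → Fin m → ℤ).
-- Step t (t : Fin N) goes from X (inject₁ t) to X (suc t).
StartsAtZero : ∀ {N m} → (Fin (suc N) → Fin m → ℤ) → Set
StartsAtZero X = ∀ i → X zero i ≡ ℤ.0ℤ

UnitSteps : ∀ {N m} → (Fin (suc N) → Fin m → ℤ) → Set
UnitSteps {N} {m} X = ∀ (t : Fin N) → ∃ λ (i : Fin m) →
  ((X (suc t) i ≡ X (inject₁ t) i ℤ.+ ℤ.1ℤ) ⊎ (X (suc t) i ≡ X (inject₁ t) i ℤ.- ℤ.1ℤ))
  × (∀ j → j ≢ i → X (suc t) j ≡ X (inject₁ t) j)

AllCoordsUsed : ∀ {N m} → (Fin (suc N) → Fin m → ℤ) → Set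
AllCoordsUsed {N} {m} X = ∀ (i : Fin m) → ∃ λ (t : Fin N) → X (suc t) i ≢ X (inject₁ t) i

toℚvec : ∀ {m} → (Fin m → ℤ) → Fin m → ℚ
toℚvec x i = x i ℚ./ 1

{-# OPTIONS --safe #-}
-- Let τ i be the first step of the walk that moves coordinate i, and take the points X (τ i + 1).
-- Coordinate j is still 0 before step τ j, so X (τ k + 1) has j-th coordinate 0 whenever τ k < τ j,
-- while its k-th coordinate has just moved away from 0; since a step moves only one coordinate,
-- τ is injective. Sorted by τ, these points are the rows of a triangular matrix with non-zero
-- diagonal, hence a basis.
module Submission where

open import Defs
open import Algebra.Bundles using (CommutativeMonoid)
import Algebra.Properties.AbelianGroup as AbelianGroupProperties
import Algebra.Properties.CommutativeSemigroup as CommutativeSemigroupProperties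
import Algebra.Properties.Ring as RingProperties
open import Data.Nat using (ℕ; zero; suc)
import Data.Nat.Properties as ℕ
open import Data.Fin using (Fin; zero; suc; toℕ; inject₁; inject; Fin′; fromℕ<; _≟_; _<_; _≤_; _>_)
open import Data.Fin.Properties
  using (<-cmp; <-irrefl; suc-injective; toℕ-injective; toℕ-inject; toℕ-inject₁; toℕ-fromℕ<;
         ¬∀⟶∃¬-smallest)
open import Data.Fin.Induction using (<-wellFounded; >-wellFounded)
open import Data.Integer as ℤ using (ℤ; 0ℤ)
open import Data.Integer.GCD using (gcd)
open import Data.Rational as ℚ using (ℚ; 0ℚ; 1ℚ; _+_; _*_; _-_; -_; 1/_)
open import Data.Rational.Properties
  using (+-assoc; +-identityˡ; +-identityʳ; +-inverseʳ; *-assoc; *-identityˡ; *-identityʳ;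
         *-zeroˡ; *-zeroʳ; *-distribˡ-+; *-distribʳ-+; *-inverseˡ; *-inverseʳ; ↥-/;
         +-0-commutativeMonoid; +-0-abelianGroup; +-*-ring)
open import Data.Product using (∃; _×_; _,_; proj₁; proj₂)
open import Function using (_∘_)
open import Function.Definitions using (Injective)
open import Induction.WellFounded using (Acc; acc)
open import Relation.Binary.Definitions using (tri<; tri≈; tri>)
open import Relation.Binary.PropositionalEquality
open import Relation.Nullary using (¬_; yes; no; contradiction)
open import Relation.Nullary.Decidable using (decidable-stable)

sumFin-cong : ∀ {n} {f g : Fin n → ℚ} → f ≗ g → sumFin f ≡ sumFin g
sumFin-cong {zero}  f≗g = refl
sumFin-cong {suc n} f≗g = cong₂ _+_ (f≗g zero) (sumFin-cong (f≗g ∘ suc))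

sumFin-zero : ∀ {n} {f : Fin n → ℚ} → (∀ k → f k ≡ 0ℚ) → sumFin f ≡ 0ℚ
sumFin-zero {zero}  f≡0 = refl
sumFin-zero {suc n} f≡0 = cong₂ _+_ (f≡0 zero) (sumFin-zero (f≡0 ∘ suc))

sumFin-+ : ∀ {n} (f g : Fin n → ℚ) → sumFin (λ k → f k + g k) ≡ sumFin f + sumFin g
sumFin-+ {zero}  f g = refl
sumFin-+ {suc n} f g = trans (cong (f zero + g zero +_) (sumFin-+ (f ∘ suc) (g ∘ suc)))
  (interchange (f zero) (g zero) (sumFin (f ∘ suc)) (sumFin (g ∘ suc)))
  where open CommutativeSemigroupProperties (CommutativeMonoid.commutativeSemigroup +-0-commutativeMonoid)

*-distribˡ-sumFin : ∀ {n} a (f : Fin n → ℚ) → a * sumFin f ≡ sumFin (λ k → a * f k)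
*-distribˡ-sumFin {zero}  a f = *-zeroʳ a
*-distribˡ-sumFin {suc n} a f =
  trans (*-distribˡ-+ a (f zero) _) (cong (a * f zero +_) (*-distribˡ-sumFin a (f ∘ suc)))

sumFin-single : ∀ {n} {f : Fin n → ℚ} j → (∀ k → k ≢ j → f k ≡ 0ℚ) → sumFin f ≡ f j
sumFin-single {f = f} zero others≡0 =
  trans (cong (f zero +_) (sumFin-zero (λ k → others≡0 (suc k) λ ()))) (+-identityʳ (f zero))
sumFin-single {f = f} (suc j) others≡0 =
  trans (cong₂ _+_ (others≡0 zero λ ())
                   (sumFin-single j λ k k≢j → others≡0 (suc k) (k≢j ∘ suc-injective)))
    (+-identityˡ (f (suc j)))

p-[p-q]≡q : ∀ p q → p - (p - q) ≡ q
p-[p-q]≡q p q = begin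
  p + - (p - q) ≡⟨ cong (p +_) (⁻¹-anti-homo‿- p q) ⟩
  p + (q - p)   ≡⟨ sym (+-assoc p q (- p)) ⟩
  p + q - p     ≡⟨ xyx⁻¹≈y p q ⟩
  q             ∎
  where
  open ≡-Reasoning
  open AbelianGroupProperties +-0-abelianGroup

p*q≡0⇒p≡0 : ∀ {p q} → q ≢ 0ℚ → p * q ≡ 0ℚ → p ≡ 0ℚ
p*q≡0⇒p≡0 {p} {q} q≢0 pq≡0 = begin
  p              ≡⟨ sym (*-identityʳ p) ⟩
  p * 1ℚ         ≡⟨ cong (p *_) (sym (*-inverseʳ q)) ⟩
  p * (q * 1/ q) ≡⟨ sym (*-assoc p q (1/ q)) ⟩
  p * q * 1/ q   ≡⟨ cong (_* 1/ q) pq≡0 ⟩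
  0ℚ * 1/ q      ≡⟨ *-zeroˡ (1/ q) ⟩
  0ℚ             ∎
  where
  open ≡-Reasoning
  instance _ = ℚ.≢-nonZero q≢0

i≢0⇒i/1≢0 : ∀ {i} → i ≢ 0ℤ → i ℚ./ 1 ≢ 0ℚ
i≢0⇒i/1≢0 {i} i≢0 i/1≡0 =
  i≢0 (trans (sym (↥-/ i 1)) (cong (λ p → ℚ.↥ p ℤ.* gcd i (ℤ.+ 1)) i/1≡0))

δ : ∀ {m} → Fin m → Fin m → ℚ
δ i j with i ≟ j
... | yes _ = 1ℚ
... | no  _ = 0ℚ

δ-refl : ∀ {m} (i : Fin m) → δ i i ≡ 1ℚ
δ-refl i with i ≟ i
... | yes _   = refl
... | no  i≢i = contradiction refl i≢i

δ-≢ : ∀ {m} {i j : Fin m} → i ≢ j → δ i j ≡ 0ℚ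
δ-≢ {i = i} {j} i≢j with i ≟ j
... | yes i≡j = contradiction i≡j i≢j
... | no  _   = refl

sumFin-*δ : ∀ {m} (w : Fin m → ℚ) j → sumFin (λ l → w l * δ l j) ≡ w j
sumFin-*δ w j = trans (sumFin-single j λ l l≢j → trans (cong (w l *_) (δ-≢ l≢j)) (*-zeroʳ (w l)))
  (trans (cong (w j *_) (δ-refl j)) (*-identityʳ (w j)))

InSpan : ∀ {k m} → (Fin k → Fin m → ℚ) → (Fin m → ℚ) → Set
InSpan v u = ∃ λ c → ∀ j → linComb c v j ≡ u j

module _ {k m} (v : Fin k → Fin m → ℚ) where

  inSpan-resp-≗ : ∀ {u u′} → u ≗ u′ → InSpan v u → InSpan v u′
  inSpan-resp-≗ u≗u′ (c , c↦u) = c , λ j → trans (c↦u j) (u≗u′ j)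

  inSpan-0 : InSpan v (λ _ → 0ℚ)
  inSpan-0 = (λ _ → 0ℚ) , λ j → sumFin-zero λ l → *-zeroˡ (v l j)

  inSpan-+ : ∀ {u u′} → InSpan v u → InSpan v u′ → InSpan v (λ j → u j + u′ j)
  inSpan-+ (c , c↦u) (c′ , c′↦u′) = (λ l → c l + c′ l) , λ j →
    trans (sumFin-cong λ l → *-distribʳ-+ (v l j) (c l) (c′ l))
      (trans (sumFin-+ (λ l → c l * v l j) (λ l → c′ l * v l j)) (cong₂ _+_ (c↦u j) (c′↦u′ j)))

  inSpan-* : ∀ a {u} → InSpan v u → InSpan v (λ j → a * u j)
  inSpan-* a (c , c↦u) = (λ l → a * c l) , λ j →
    trans (sumFin-cong λ l → *-assoc a (c l) (v l j))
      (trans (sym (*-distribˡ-sumFin a (λ l → c l * v l j))) (cong (a *_) (c↦u j)))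

  inSpan-- : ∀ {u u′} → InSpan v u → InSpan v u′ → InSpan v (λ j → u j - u′ j)
  inSpan-- {u} {u′} u∈ u′∈ =
    inSpan-resp-≗ (λ j → cong (u j +_) (-1*x≈-x (u′ j))) (inSpan-+ u∈ (inSpan-* (- 1ℚ) u′∈))
    where open RingProperties +-*-ring using (-1*x≈-x)

  inSpan-sumFin : ∀ {n} (w : Fin n → Fin m → ℚ) → (∀ l → InSpan v (w l)) →
    InSpan v (λ j → sumFin (λ l → w l j))
  inSpan-sumFin {zero}  w w∈ = inSpan-0
  inSpan-sumFin {suc n} w w∈ = inSpan-+ (w∈ zero) (inSpan-sumFin (w ∘ suc) (w∈ ∘ suc))

  inSpan-member : ∀ i → InSpan v (v i)
  inSpan-member i = δ i , λ j →
    trans (sumFin-single i λ l l≢i → trans (cong (_* v l j) (δ-≢ (l≢i ∘ sym))) (*-zeroˡ (v l j)))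
      (trans (cong (_* v i j) (δ-refl i)) (*-identityˡ (v i j)))

  δ-inSpan⇒spans : (∀ i → InSpan v (δ i)) → Spans v
  δ-inSpan⇒spans δ∈ w =
    inSpan-resp-≗ (sumFin-*δ w) (inSpan-sumFin (λ l j → w l * δ l j) λ l → inSpan-* (w l) (δ∈ l))

-- Once rows and columns are sorted by the rank r, the matrix v is lower triangular.
module LowerTriangular {m n} (v : Fin m → Fin m → ℚ) (r : Fin m → Fin n)
  (r-injective : Injective _≡_ _≡_ r)
  (zero-above-diagonal : ∀ k j → r k < r j → v k j ≡ 0ℚ)
  (diagonal≢0 : ∀ j → v j j ≢ 0ℚ) where

  linearlyIndependent : LinearlyIndependent v
  linearlyIndependent c c↦0 j = go j (>-wellFounded (r j))
    where
    -- Only c j and the c k with r k > r j contribute to coordinate j of the combination.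
    go : ∀ j → Acc _>_ (r j) → c j ≡ 0ℚ
    go j (acc later) = p*q≡0⇒p≡0 (diagonal≢0 j) (trans (sym (sumFin-single j term≡0)) (c↦0 j))
      where
      term≡0 : ∀ k → k ≢ j → c k * v k j ≡ 0ℚ
      term≡0 k k≢j with <-cmp (r k) (r j)
      ... | tri< rk<rj _ _ = trans (cong (c k *_) (zero-above-diagonal k j rk<rj)) (*-zeroʳ (c k))
      ... | tri≈ _ rk≡rj _ = contradiction (r-injective rk≡rj) k≢j
      ... | tri> _ _ rk>rj = trans (cong (_* v k j) (go k (later rk>rj))) (*-zeroˡ (v k j))

  -- δ i = (v i - offDiagonal) / d, and offDiagonal l ≠ 0 only when r l < r i.
  δ-inSpan-from-earlier : ∀ i → (∀ l → r l < r i → InSpan v (δ l)) → InSpan v (δ i)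
  δ-inSpan-from-earlier i earlier∈ =
    inSpan-resp-≗ v δ≗ (inSpan-* v (1/ d) (inSpan-- v (inSpan-member v i) offDiagonal∈))
    where
    d = v i i
    instance _ = ℚ.≢-nonZero (diagonal≢0 i)

    offDiagonal : Fin m → ℚ
    offDiagonal j = v i j - d * δ i j

    offDiagonal-at-i : offDiagonal i ≡ 0ℚ
    offDiagonal-at-i = begin
      d - d * δ i i ≡⟨ cong (λ x → d - d * x) (δ-refl i) ⟩
      d - d * 1ℚ    ≡⟨ cong (λ x → d - x) (*-identityʳ d) ⟩
      d - d         ≡⟨ +-inverseʳ d ⟩
      0ℚ            ∎
      where open ≡-Reasoning

    offDiagonal-later : ∀ l → r i < r l → offDiagonal l ≡ 0ℚ
    offDiagonal-later l ri<rl = begin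
      v i l - d * δ i l ≡⟨ cong₂ (λ x y → x - d * y) (zero-above-diagonal i l ri<rl) (δ-≢ i≢l) ⟩
      0ℚ - d * 0ℚ       ≡⟨ cong (λ x → 0ℚ - x) (*-zeroʳ d) ⟩
      0ℚ                ∎
      where
      open ≡-Reasoning
      i≢l : i ≢ l
      i≢l refl = <-irrefl refl ri<rl

    vanishing-term∈ : ∀ {a} l → a ≡ 0ℚ → InSpan v (λ j → a * δ l j)
    vanishing-term∈ l refl = inSpan-resp-≗ v (λ j → sym (*-zeroˡ (δ l j))) (inSpan-0 v)

    term∈ : ∀ l → InSpan v (λ j → offDiagonal l * δ l j)
    term∈ l with <-cmp (r l) (r i)
    ... | tri< rl<ri _ _ = inSpan-* v (offDiagonal l) (earlier∈ l rl<ri)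
    ... | tri≈ _ rl≡ri _ =
      vanishing-term∈ l (subst (λ l → offDiagonal l ≡ 0ℚ) (sym (r-injective rl≡ri)) offDiagonal-at-i)
    ... | tri> _ _ rl>ri = vanishing-term∈ l (offDiagonal-later l rl>ri)

    offDiagonal∈ : InSpan v offDiagonal
    offDiagonal∈ = inSpan-resp-≗ v (sumFin-*δ offDiagonal) (inSpan-sumFin v _ term∈)

    δ≗ : ∀ j → 1/ d * (v i j - offDiagonal j) ≡ δ i j
    δ≗ j = begin
      1/ d * (v i j - (v i j - d * δ i j)) ≡⟨ cong (1/ d *_) (p-[p-q]≡q (v i j) (d * δ i j)) ⟩
      1/ d * (d * δ i j)                   ≡⟨ sym (*-assoc (1/ d) d (δ i j)) ⟩
      1/ d * d * δ i j                     ≡⟨ cong (_* δ i j) (*-inverseˡ d) ⟩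
      1ℚ * δ i j                           ≡⟨ *-identityˡ (δ i j) ⟩
      δ i j                                ∎
      where open ≡-Reasoning

  spans : Spans v
  spans = δ-inSpan⇒spans v λ i → go i (<-wellFounded (r i))
    where
    go : ∀ i → Acc _<_ (r i) → InSpan v (δ i)
    go i (acc earlier) = δ-inSpan-from-earlier i λ l rl<ri → go l (earlier rl<ri)

  isBasis : IsBasis v
  isBasis = linearlyIndependent , spans

constant-until : ∀ {a} {A : Set a} {N} (f : Fin (suc N) → A) p →
  (∀ (s : Fin N) → s < p → f (suc s) ≡ f (inject₁ s)) → f p ≡ f zero
constant-until f zero steady = refl
constant-until {N = suc N} f (suc q) steady =
  trans (steady q (ℕ.n<1+n (toℕ q))) (constant-until (f ∘ inject₁) q steady-before-q)
  where
  steady-before-q : ∀ s → s < q → f (suc (inject₁ s)) ≡ f (inject₁ (inject₁ s))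
  steady-before-q s s<q =
    steady (inject₁ s) (ℕ.≤-trans (ℕ.≤-reflexive (cong suc (toℕ-inject₁ s))) (ℕ.m<n⇒m<1+n s<q))

changed-coordinate-unique : ∀ {N m} {X : Fin (suc N) → Fin m → ℤ} → UnitSteps X → ∀ t {i j} →
  X (suc t) i ≢ X (inject₁ t) i → X (suc t) j ≢ X (inject₁ t) j → i ≡ j
changed-coordinate-unique {X = X} unitSteps t i-changes j-changes =
  trans (isChanged i-changes) (sym (isChanged j-changes))
  where
  changed = proj₁ (unitSteps t)
  isChanged : ∀ {i} → X (suc t) i ≢ X (inject₁ t) i → i ≡ changed
  isChanged {i} i-changes = decidable-stable (i ≟ changed) (i-changes ∘ proj₂ (proj₂ (unitSteps t)) i)

module FirstChange {N m} (X : Fin (suc N) → Fin m → ℤ) (allUsed : AllCoordsUsed X) where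

  Steady : Fin m → Fin N → Set
  Steady i t = X (suc t) i ≡ X (inject₁ t) i

  private
    smallest : ∀ i → ∃ λ t → ¬ Steady i t × ((s : Fin′ t) → Steady i (inject s))
    smallest i = ¬∀⟶∃¬-smallest N (Steady i) (λ t → X (suc t) i ℤ.≟ X (inject₁ t) i)
      λ allSteady → proj₂ (allUsed i) (allSteady (proj₁ (allUsed i)))

  firstChange : Fin m → Fin N
  firstChange i = proj₁ (smallest i)

  changes-at-firstChange : ∀ i → ¬ Steady i (firstChange i)
  changes-at-firstChange i = proj₁ (proj₂ (smallest i))

  steady-before-firstChange : ∀ i s → s < firstChange i → Steady i s
  steady-before-firstChange i s s<τ =
    subst (Steady i) (toℕ-injective (trans (toℕ-inject s′) (toℕ-fromℕ< s<τ)))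
      (proj₂ (proj₂ (smallest i)) s′)
    where s′ = fromℕ< s<τ

  firstChange-injective : UnitSteps X → Injective _≡_ _≡_ firstChange
  firstChange-injective unitSteps {i} {j} τi≡τj =
    changed-coordinate-unique {X = X} unitSteps (firstChange i)
      (changes-at-firstChange i) (subst (λ t → ¬ Steady j t) (sym τi≡τj) (changes-at-firstChange j))

  zero-until-firstChange : StartsAtZero X → ∀ {p} j → p ≤ firstChange j → X p j ≡ 0ℤ
  zero-until-firstChange start {p} j p≤τ =
    trans (constant-until (λ q → X q j) p λ s s<p → steady-before-firstChange j s (ℕ.<-≤-trans s<p p≤τ))
      (start j)

  nonzero-after-firstChange : StartsAtZero X → ∀ j → X (suc (firstChange j)) j ≢ 0ℤ
  nonzero-after-firstChange start j X≡0 = changes-at-firstChange j (trans X≡0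
    (sym (zero-until-firstChange start j (ℕ.≤-reflexive (toℕ-inject₁ (firstChange j))))))

lemma4p1 : (N m : ℕ) (X : Fin (suc N) → Fin m → ℤ) →
    StartsAtZero X → UnitSteps X → AllCoordsUsed X →
    ∃ λ (ts : Fin m → Fin (suc N)) → IsBasis (λ j → toℚvec (X (ts j)))
lemma4p1 N m X start unitSteps allUsed =
  suc ∘ firstChange ,
  LowerTriangular.isBasis rows firstChange (firstChange-injective unitSteps)
    (λ k j τk<τj → cong (ℚ._/ 1) (zero-until-firstChange start j τk<τj))
    (λ j → i≢0⇒i/1≢0 (nonzero-after-firstChange start j))
  where
  open FirstChange X allUsed
  rows : Fin m → Fin m → ℚ
  rows k = toℚvec (X (suc (firstChange k)))
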